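{- Let $\Sigma$ be an ordered alphabet of size $\sigma$. For any $\sigma$ and $n$ such that $\sigma<n$, the sum over all strings $w\in\Sigma^n$ of the number of distinct Lyndon subsequences of $w$ is \[ \mathit{TDS}(\sigma,n)=\sum_{m=1}^{n}\left[L(\sigma,m)\sum_{k=m}^{n}\binom{n}{k}(\sigma-1)^{n-k}\right], \] and the expected number of distinct Lyndon subsequences in a uniformly random string of $\Sigma^n$ is $\mathit{EDS}(\sigma,n)=\mathit{TDS}(\sigma,n)/\sigma^n$.
   Context: A string over an ordered alphabet is a Lyndon word if it is non-empty and lexicographically strictly smaller than all its non-empty proper suffixes. $L(\sigma,m)$ denotes the number of Lyndon words of length $m$ over an alphabet of size $\sigma$. A string $x$ is a subsequence of $w$ if $x=w[i_1]\cdots w[i_{|x|}]$ for some $1\le i_1<\dots<i_{|x|}\le|w|$; the number of distinct Lyndon subsequences of $w$ is the number of distinct Lyndon words that are subsequences of $w$. -}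

module Defs where

open import Data.Nat using (ℕ; zero; suc; _+_; _*_; _∸_; _^_)
import Data.Nat as ℕ
open import Data.Nat.Combinatorics using (_C_)
open import Data.Fin using (Fin; toℕ)
import Data.Fin as Fin
open import Data.Fin.Properties using (all?) renaming (_≟_ to _≟ᶠ_; _<?_ to _<ᶠ?_)
open import Data.List using (List; []; _∷_; length; drop; map; upTo; concatMap; allFin; filter)
open import Data.Nat.ListAction using (sum)
open import Data.List.Relation.Binary.Lex.Strict using (Lex-<; <-decidable)
open import Data.List.Relation.Binary.Sublist.Propositional using (_⊆_)
open import Level using (0ℓ)
open import Data.Product using (_×_; proj₁)
open import Relation.Binary.PropositionalEquality using (_≡_; _≢_; refl)
open import Relation.Nullary using (Dec; yes; no; ¬_)
open import Relation.Nullary.Decidable using (_×-dec_; ¬?; _→-dec_)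
open import Relation.Unary using (Pred; Decidable)

-- Strict lexicographic order on strings (a proper prefix is smaller).
_<lex_ : ∀ {σ} → List (Fin σ) → List (Fin σ) → Set
_<lex_ = Lex-< _≡_ Fin._<_

_<lex?_ : ∀ {σ} (x y : List (Fin σ)) → Dec (x <lex y)
_<lex?_ = <-decidable _≟ᶠ_ _<ᶠ?_

-- Lyndon word: non-empty and strictly smaller than every non-empty proper
-- suffix.  The non-empty proper suffixes of x are  drop i x  with 0 < i < |x|.
IsLyndon : ∀ {σ} → List (Fin σ) → Set
IsLyndon x = (x ≢ []) × ((i : Fin (length x)) → 0 ℕ.< toℕ i → x <lex drop (toℕ i) x)

isLyndon? : ∀ {σ} → Decidable (IsLyndon {σ})
isLyndon? [] = no λ p → proj₁ p refl
isLyndon? (a ∷ x) =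
  ¬? (no λ ()) ×-dec all? (λ i → (0 ℕ.<? toℕ i) →-dec ((a ∷ x) <lex? drop (toℕ i) (a ∷ x)))

words : (σ m : ℕ) → List (List (Fin σ))
words σ zero    = [] ∷ []
words σ (suc m) = concatMap (λ a → map (a ∷_) (words σ m)) (allFin σ)

countOfLength : ∀ {σ} {P : Pred (List (Fin σ)) 0ℓ} → Decidable P → ℕ → ℕ
countOfLength {σ} P? m = length (filter P? (words σ m))

L : ℕ → ℕ → ℕ
L σ m = countOfLength {σ} isLyndon? m

-- ∑_{k=a}^{b} f k  (empty when b < a).
∑[_⋯_] : ℕ → ℕ → (ℕ → ℕ) → ℕ
∑[ a ⋯ b ] f = sum (map (λ i → f (a + i)) (upTo (suc b ∸ a)))

-- Such x have length
-- at most |w|, so we count over all strings of length 0..|w|.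
IsLyndonSubseq : ∀ {σ} → List (Fin σ) → List (Fin σ) → Set
IsLyndonSubseq w x = IsLyndon x × (x ⊆ w)

numLyndonSubseq : ∀ {σ} → List (Fin σ) → ℕ
numLyndonSubseq {σ} w =
  ∑[ 0 ⋯ length w ] (countOfLength {σ} (λ x → isLyndon? x ×-dec (x ⊆? w)))
  where open import Data.List.Relation.Binary.Sublist.DecPropositional (_≟ᶠ_ {σ}) using (_⊆?_)

totalLyndonSubseq : ℕ → ℕ → ℕ
totalLyndonSubseq σ n = sum (map numLyndonSubseq (words σ n))

TDS : ℕ → ℕ → ℕ
TDS σ n = ∑[ 1 ⋯ n ] (λ m → L σ m * ∑[ m ⋯ n ] (λ k → (n C k) * (σ ∸ 1) ^ (n ∸ k)))

-- For σ ≥ 1, the number of strings w of length n containing a fixed string x of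
-- length m as a subsequence depends only on m: splitting on the first letter of w
-- and matching x greedily gives N(b ∷ x, n + 1) = N(x, n) + (σ − 1) N(b ∷ x, n) and
-- N([], n + 1) = σ N([], n), and Pascal's rule shows that the binomial tail
-- ∑_{k ≥ m} C(n,k) (σ − 1)^(n − k) satisfies the same recurrences.  Counting the
-- pairs (w, x) with x a Lyndon subsequence of w by x instead of by w then yields
-- ∑_m L(σ, m) times that tail.
module Submission where

open import Defs
open import Data.Nat using (ℕ; zero; suc; _+_; _*_; _∸_; _^_; _<_; s≤s)
open import Data.Nat.Properties
open import Algebra.Properties.CommutativeSemigroup +-commutativeSemigroup
  using () renaming (interchange to +-interchange; x∙yz≈y∙xz to x+[y+z]≡y+[x+z])
open import Algebra.Properties.CommutativeSemigroup *-commutativeSemigroup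
  using () renaming (x∙yz≈y∙xz to x*[y*z]≡y*[x*z])
open import Data.Nat.Combinatorics using (_C_; k>n⇒nCk≡0; nCk+nC[k+1]≡[n+1]C[k+1])
open import Data.Nat.ListAction using (sum)
open import Data.Nat.ListAction.Properties using (sum-++)
open import Data.Bool using (if_then_else_)
open import Data.Fin using (Fin)
import Data.Fin as Fin
import Data.Fin.Properties as Finₚ
open import Data.Fin.Properties using () renaming (_≟_ to _≟ᶠ_)
open import Data.List
  using (List; []; _∷_; [_]; _++_; _∷ʳ_; length; map; upTo; tabulate; allFin; filter; concatMap)
open import Data.List.Properties
  using (map-cong; map-cong-local; map-∘; map-++; map-applyUpTo; map-upTo; map-tabulate; tabulate-cong; applyUpTo-∷ʳ)
open import Data.List.Relation.Unary.All using (All)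
import Data.List.Relation.Unary.All as All
open import Data.List.Relation.Unary.All.Properties using (concat⁺; map⁺; gmap⁺; tabulate⁺)
open import Data.List.Relation.Binary.Sublist.Propositional using (minimum)
open import Data.List.Relation.Binary.Sublist.Propositional.Properties using (∷⁻¹; ∷ʳ⁻¹)
open import Data.Product using (_,_)
open import Data.Empty using (⊥-elim)
open import Function using (_∘_; _⇔_; mk⇔)
open import Level using (0ℓ)
open import Relation.Binary.PropositionalEquality
  using (_≡_; _≢_; refl; sym; trans; cong; cong₂; module ≡-Reasoning)
open import Relation.Nullary using (Dec; yes; no; does)
open import Relation.Nullary.Decidable using (_×-dec_; does-⇔)
open import Relation.Unary using (Pred; Decidable)
open ≡-Reasoning

module _ {A : Set} where

  sum-map-+ : ∀ (f g : A → ℕ) xs →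
              sum (map (λ x → f x + g x) xs) ≡ sum (map f xs) + sum (map g xs)
  sum-map-+ f g []       = refl
  sum-map-+ f g (x ∷ xs) = begin
    f x + g x + sum (map (λ x → f x + g x) xs)      ≡⟨ cong (f x + g x +_) (sum-map-+ f g xs) ⟩
    f x + g x + (sum (map f xs) + sum (map g xs))   ≡⟨ +-interchange (f x) (g x) _ _ ⟩
    f x + sum (map f xs) + (g x + sum (map g xs))   ∎

  sum-map-*ˡ : ∀ c (f : A → ℕ) xs → sum (map (λ x → c * f x) xs) ≡ c * sum (map f xs)
  sum-map-*ˡ c f []       = sym (*-zeroʳ c)
  sum-map-*ˡ c f (x ∷ xs) =
    trans (cong (c * f x +_) (sum-map-*ˡ c f xs)) (sym (*-distribˡ-+ c (f x) _))

  sum-map-*ʳ : ∀ c (f : A → ℕ) xs → sum (map (λ x → f x * c) xs) ≡ sum (map f xs) * c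
  sum-map-*ʳ c f []       = refl
  sum-map-*ʳ c f (x ∷ xs) =
    trans (cong (f x * c +_) (sum-map-*ʳ c f xs)) (sym (*-distribʳ-+ c (f x) _))

  sum-map-++ : ∀ (f : A → ℕ) xs ys → sum (map f (xs ++ ys)) ≡ sum (map f xs) + sum (map f ys)
  sum-map-++ f xs ys = trans (cong sum (map-++ f xs ys)) (sum-++ (map f xs) (map f ys))

module _ {A B : Set} where

  sum-map-comm : ∀ (F : A → B → ℕ) xs ys →
                 sum (map (λ x → sum (map (F x) ys)) xs) ≡ sum (map (λ y → sum (map (λ x → F x y) xs)) ys)
  sum-map-comm F []       ys = sym (sum-map-*ˡ 0 (λ _ → 0) ys)
  sum-map-comm F (x ∷ xs) ys =
    trans (cong (sum (map (F x) ys) +_) (sum-map-comm F xs ys)) (sym (sum-map-+ (F x) _ ys))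

  sum-map-concatMap : ∀ (f : B → ℕ) (g : A → List B) xs →
                      sum (map f (concatMap g xs)) ≡ sum (map (λ x → sum (map f (g x))) xs)
  sum-map-concatMap f g []       = refl
  sum-map-concatMap f g (x ∷ xs) =
    trans (sum-map-++ f (g x) _) (cong (sum (map f (g x)) +_) (sum-map-concatMap f g xs))

𝟙 : {P : Set} → Dec P → ℕ
𝟙 P? = if does P? then 1 else 0

𝟙-⇔ : {P Q : Set} → P ⇔ Q → (P? : Dec P) (Q? : Dec Q) → 𝟙 P? ≡ 𝟙 Q?
𝟙-⇔ P⇔Q P? Q? = cong (λ b → if b then 1 else 0) (does-⇔ P⇔Q P? Q?)

𝟙-×-dec : {P Q : Set} (P? : Dec P) (Q? : Dec Q) → 𝟙 (P? ×-dec Q?) ≡ 𝟙 P? * 𝟙 Q?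
𝟙-×-dec (yes _) Q? = sym (+-identityʳ (𝟙 Q?))
𝟙-×-dec (no _)  Q? = refl

length-filter≡sum-𝟙 : {A : Set} {P : Pred A 0ℓ} (P? : Decidable P) (xs : List A) →
                       length (filter P? xs) ≡ sum (map (𝟙 ∘ P?) xs)
length-filter≡sum-𝟙 P? []       = refl
length-filter≡sum-𝟙 P? (x ∷ xs) with P? x
... | yes _ = cong suc (length-filter≡sum-𝟙 P? xs)
... | no  _ = length-filter≡sum-𝟙 P? xs

sum-tabulate-const : ∀ n (g : Fin n → ℕ) {v} → (∀ a → g a ≡ v) → sum (tabulate g) ≡ n * v
sum-tabulate-const zero    g g≡v = refl
sum-tabulate-const (suc n) g g≡v = cong₂ _+_ (g≡v Fin.zero) (sum-tabulate-const n (g ∘ Fin.suc) (g≡v ∘ Fin.suc))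

sum-tabulate-except : ∀ c (b : Fin (suc c)) (g : Fin (suc c) → ℕ) {v} →
                      (∀ a → a ≢ b → g a ≡ v) → sum (tabulate g) ≡ g b + c * v
sum-tabulate-except c Fin.zero g g≡v =
  cong (g Fin.zero +_) (sum-tabulate-const c (g ∘ Fin.suc) (λ a → g≡v (Fin.suc a) λ ()))
sum-tabulate-except (suc c) (Fin.suc b) g {v} g≡v = begin
  g Fin.zero + sum (tabulate (g ∘ Fin.suc))   ≡⟨ cong₂ _+_ (g≡v Fin.zero λ ()) rest ⟩
  v + (g (Fin.suc b) + c * v)                  ≡⟨ x+[y+z]≡y+[x+z] v (g (Fin.suc b)) (c * v) ⟩
  g (Fin.suc b) + (v + c * v)                  ∎
  where
  rest : sum (tabulate (g ∘ Fin.suc)) ≡ g (Fin.suc b) + c * v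
  rest = sum-tabulate-except c b (g ∘ Fin.suc) (λ a a≢b → g≡v (Fin.suc a) (a≢b ∘ Finₚ.suc-injective))

words-length : ∀ σ n → All (λ w → length w ≡ n) (words σ n)
words-length σ zero    = refl All.∷ All.[]
words-length σ (suc n) = concat⁺ (map⁺ (tabulate⁺ {f = λ a → a} extend))
  where
  extend : ∀ a → All (λ w → length w ≡ suc n) (map (a ∷_) (words σ n))
  extend a = gmap⁺ (cong suc) (words-length σ n)

sum-words-suc : ∀ σ n (f : List (Fin σ) → ℕ) →
                sum (map f (words σ (suc n))) ≡ sum (tabulate λ a → sum (map (f ∘ (a ∷_)) (words σ n)))
sum-words-suc σ n f = begin
  sum (map f (words σ (suc n)))
    ≡⟨ sum-map-concatMap f (λ a → map (a ∷_) (words σ n)) (allFin σ) ⟩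
  sum (map (λ a → sum (map f (map (a ∷_) (words σ n)))) (allFin σ))
    ≡⟨ cong sum (map-tabulate (λ a → a) (λ a → sum (map f (map (a ∷_) (words σ n))))) ⟩
  sum (tabulate λ a → sum (map f (map (a ∷_) (words σ n))))
    ≡⟨ cong sum (tabulate-cong λ a → cong sum (sym (map-∘ {g = f} {f = a ∷_} (words σ n)))) ⟩
  sum (tabulate λ a → sum (map (f ∘ (a ∷_)) (words σ n)))   ∎

∑[0⋯]-peel : ∀ n (f : ℕ → ℕ) → ∑[ 0 ⋯ n ] f ≡ f 0 + ∑[ 1 ⋯ n ] f
∑[0⋯]-peel n f = cong (f 0 +_) (cong sum (trans (map-applyUpTo suc f n) (sym (map-upTo (f ∘ suc) n))))

sum-map-upTo-suc : ∀ (g : ℕ → ℕ) r → sum (map g (upTo (suc r))) ≡ sum (map g (upTo r)) + g r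
sum-map-upTo-suc g r = begin
  sum (map g (upTo (suc r)))           ≡⟨ cong (sum ∘ map g) (sym (applyUpTo-∷ʳ (λ i → i) r)) ⟩
  sum (map g (upTo r ∷ʳ r))            ≡⟨ sum-map-++ g (upTo r) [ r ] ⟩
  sum (map g (upTo r)) + (g r + 0)     ≡⟨ cong (sum (map g (upTo r)) +_) (+-identityʳ (g r)) ⟩
  sum (map g (upTo r)) + g r           ∎

∑⋯-drop-last-zero : ∀ m n (f : ℕ → ℕ) → f (suc n) ≡ 0 → ∑[ m ⋯ suc n ] f ≡ ∑[ m ⋯ n ] f
∑⋯-drop-last-zero m n f fsn≡0 with m ≤? suc n
... | yes m≤sn = begin
  sum (map (f ∘ (m +_)) (upTo (suc (suc n) ∸ m)))
    ≡⟨ cong (sum ∘ map (f ∘ (m +_)) ∘ upTo) (+-∸-assoc 1 m≤sn) ⟩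
  sum (map (f ∘ (m +_)) (upTo (suc (suc n ∸ m))))
    ≡⟨ sum-map-upTo-suc (f ∘ (m +_)) (suc n ∸ m) ⟩
  ∑[ m ⋯ n ] f + f (m + (suc n ∸ m))   ≡⟨ cong (λ k → ∑[ m ⋯ n ] f + f k) (m+[n∸m]≡n m≤sn) ⟩
  ∑[ m ⋯ n ] f + f (suc n)             ≡⟨ cong (∑[ m ⋯ n ] f +_) fsn≡0 ⟩
  ∑[ m ⋯ n ] f + 0                     ≡⟨ +-identityʳ _ ⟩
  ∑[ m ⋯ n ] f                         ∎
... | no m≰sn = trans (cong (sum ∘ map (f ∘ (m +_)) ∘ upTo) (m≤n⇒m∸n≡0 sn<m))
                      (sym (cong (sum ∘ map (f ∘ (m +_)) ∘ upTo) (m≤n⇒m∸n≡0 (<⇒≤ sn<m))))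
  where
  sn<m : suc n < m
  sn<m = ≰⇒> m≰sn

module BinomialTail (c : ℕ) where

  term : ℕ → ℕ → ℕ
  term n k = (n C k) * c ^ (n ∸ k)

  tail : ℕ → ℕ → ℕ
  tail n m = ∑[ m ⋯ n ] (term n)

  tail-zero-suc : ∀ m → tail 0 (suc m) ≡ 0
  tail-zero-suc m = cong (λ r → sum (map (term 0 ∘ (suc m +_)) (upTo r))) (0∸n≡0 m)

  term-vanishes : ∀ {n k} → n < k → term n k ≡ 0
  term-vanishes {n} {k} n<k = cong (_* c ^ (n ∸ k)) (k>n⇒nCk≡0 n<k)

  term-suc-zero : ∀ n → term (suc n) 0 ≡ c * term n 0
  term-suc-zero n = trans (*-identityˡ _) (cong (c *_) (sym (*-identityˡ _)))

  term-pascal : ∀ n k → term (suc n) (suc k) ≡ term n k + c * term n (suc k)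
  term-pascal n k = begin
    (suc n C suc k) * c ^ (n ∸ k)                      ≡⟨ cong (_* c ^ (n ∸ k)) (sym (nCk+nC[k+1]≡[n+1]C[k+1] n k)) ⟩
    ((n C k) + (n C suc k)) * c ^ (n ∸ k)              ≡⟨ *-distribʳ-+ (c ^ (n ∸ k)) (n C k) _ ⟩
    term n k + (n C suc k) * c ^ (n ∸ k)               ≡⟨ cong (term n k +_) (lower-exponent k) ⟩
    term n k + c * term n (suc k)                       ∎
    where
    -- n ∸ k = suc (n ∸ suc k) only when k < n; otherwise both sides vanish.
    lower-exponent : ∀ k → (n C suc k) * c ^ (n ∸ k) ≡ c * term n (suc k)
    lower-exponent k with k <? n
    ... | yes k<n = begin
      (n C suc k) * c ^ (n ∸ k)            ≡⟨ cong (λ e → (n C suc k) * c ^ e) (+-∸-assoc 1 k<n) ⟩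
      (n C suc k) * (c * c ^ (n ∸ suc k))  ≡⟨ x*[y*z]≡y*[x*z] (n C suc k) c _ ⟩
      c * term n (suc k)                    ∎
    ... | no k≮n = begin
      (n C suc k) * c ^ (n ∸ k)  ≡⟨ cong (_* c ^ (n ∸ k)) (k>n⇒nCk≡0 (s≤s (≮⇒≥ k≮n))) ⟩
      0                          ≡⟨ sym (*-zeroʳ c) ⟩
      c * 0                      ≡⟨ cong (c *_) (sym (term-vanishes (s≤s (≮⇒≥ k≮n)))) ⟩
      c * term n (suc k)         ∎

  tail-pascal : ∀ n m → tail (suc n) (suc m) ≡ tail n m + c * tail n (suc m)
  tail-pascal n m = begin
    ∑[ m ⋯ n ] (term (suc n) ∘ suc)
      ≡⟨ cong sum (map-cong (λ i → term-pascal n (m + i)) (upTo (suc n ∸ m))) ⟩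
    ∑[ m ⋯ n ] (λ k → term n k + c * term n (suc k))
      ≡⟨ sum-map-+ (λ i → term n (m + i)) (λ i → c * term n (suc m + i)) (upTo (suc n ∸ m)) ⟩
    tail n m + ∑[ m ⋯ n ] (λ k → c * term n (suc k))
      ≡⟨ cong (tail n m +_) (sum-map-*ˡ c (λ i → term n (suc m + i)) (upTo (suc n ∸ m))) ⟩
    tail n m + c * ∑[ suc m ⋯ suc n ] (term n)
      ≡⟨ cong (λ t → tail n m + c * t) (∑⋯-drop-last-zero (suc m) n (term n) (term-vanishes (n<1+n n))) ⟩
    tail n m + c * tail n (suc m)   ∎

  tail-suc-zero : ∀ n → tail (suc n) 0 ≡ suc c * tail n 0
  tail-suc-zero n = begin
    tail (suc n) 0                                ≡⟨ ∑[0⋯]-peel (suc n) (term (suc n)) ⟩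
    term (suc n) 0 + tail (suc n) 1               ≡⟨ cong₂ _+_ (term-suc-zero n) (tail-pascal n 0) ⟩
    c * term n 0 + (tail n 0 + c * tail n 1)      ≡⟨ x+[y+z]≡y+[x+z] (c * term n 0) (tail n 0) _ ⟩
    tail n 0 + (c * term n 0 + c * tail n 1)      ≡⟨ cong (tail n 0 +_) (sym (*-distribˡ-+ c (term n 0) _)) ⟩
    tail n 0 + c * (term n 0 + tail n 1)          ≡⟨ cong (λ t → tail n 0 + c * t) (sym (∑[0⋯]-peel n (term n))) ⟩
    tail n 0 + c * tail n 0                       ∎

#supersequences : ∀ σ → List (Fin σ) → ℕ → ℕ
#supersequences σ x n = sum (map (λ w → 𝟙 (x ⊆? w)) (words σ n))
  where open import Data.List.Relation.Binary.Sublist.DecPropositional (_≟ᶠ_ {σ}) using (_⊆?_)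

module _ (c : ℕ) where
  open import Data.List.Relation.Binary.Sublist.DecPropositional (_≟ᶠ_ {suc c}) using (_⊆?_)
  open BinomialTail c

  #supersequences-[]-suc : ∀ n → #supersequences (suc c) [] (suc n) ≡ suc c * #supersequences (suc c) [] n
  #supersequences-[]-suc n = begin
    #supersequences (suc c) [] (suc n)
      ≡⟨ sum-words-suc (suc c) n (λ w → 𝟙 ([] ⊆? w)) ⟩
    sum (tabulate λ a → sum (map (λ w → 𝟙 ([] ⊆? a ∷ w)) (words (suc c) n)))
      ≡⟨ sum-tabulate-const (suc c) _ (λ a → cong sum (map-cong (drop-letter a) (words (suc c) n))) ⟩
    suc c * #supersequences (suc c) [] n   ∎
    where
    drop-letter : ∀ a w → 𝟙 ([] ⊆? a ∷ w) ≡ 𝟙 ([] ⊆? w)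
    drop-letter a w = 𝟙-⇔ (mk⇔ (λ _ → minimum w) (λ _ → minimum (a ∷ w))) ([] ⊆? a ∷ w) ([] ⊆? w)

  #supersequences-∷-suc : ∀ b x n →
    #supersequences (suc c) (b ∷ x) (suc n) ≡ #supersequences (suc c) x n + c * #supersequences (suc c) (b ∷ x) n
  #supersequences-∷-suc b x n = begin
    #supersequences (suc c) (b ∷ x) (suc n)
      ≡⟨ sum-words-suc (suc c) n (λ w → 𝟙 (b ∷ x ⊆? w)) ⟩
    sum (tabulate λ a → sum (map (λ w → 𝟙 (b ∷ x ⊆? a ∷ w)) (words (suc c) n)))
      ≡⟨ sum-tabulate-except c b _ (λ a a≢b → cong sum (map-cong (skip-letter a≢b) (words (suc c) n))) ⟩
    sum (map (λ w → 𝟙 (b ∷ x ⊆? b ∷ w)) (words (suc c) n)) + c * #supersequences (suc c) (b ∷ x) n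
      ≡⟨ cong (_+ c * #supersequences (suc c) (b ∷ x) n) (cong sum (map-cong match-letter (words (suc c) n))) ⟩
    #supersequences (suc c) x n + c * #supersequences (suc c) (b ∷ x) n   ∎
    where
    match-letter : ∀ w → 𝟙 (b ∷ x ⊆? b ∷ w) ≡ 𝟙 (x ⊆? w)
    match-letter w = sym (𝟙-⇔ (∷⁻¹ refl) (x ⊆? w) (b ∷ x ⊆? b ∷ w))
    skip-letter : ∀ {a} → a ≢ b → ∀ w → 𝟙 (b ∷ x ⊆? a ∷ w) ≡ 𝟙 (b ∷ x ⊆? w)
    skip-letter {a} a≢b w = sym (𝟙-⇔ (∷ʳ⁻¹ (a≢b ∘ sym)) (b ∷ x ⊆? w) (b ∷ x ⊆? a ∷ w))

  #supersequences≡tail : ∀ n x → #supersequences (suc c) x n ≡ tail n (length x)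
  #supersequences≡tail zero    []      = refl
  #supersequences≡tail zero    (b ∷ x) = sym (tail-zero-suc (length x))
  #supersequences≡tail (suc n) []      = begin
    #supersequences (suc c) [] (suc n)   ≡⟨ #supersequences-[]-suc n ⟩
    suc c * #supersequences (suc c) [] n ≡⟨ cong (suc c *_) (#supersequences≡tail n []) ⟩
    suc c * tail n 0                     ≡⟨ sym (tail-suc-zero n) ⟩
    tail (suc n) 0                       ∎
  #supersequences≡tail (suc n) (b ∷ x) = begin
    #supersequences (suc c) (b ∷ x) (suc n)
      ≡⟨ #supersequences-∷-suc b x n ⟩
    #supersequences (suc c) x n + c * #supersequences (suc c) (b ∷ x) n
      ≡⟨ cong₂ (λ s t → s + c * t) (#supersequences≡tail n x) (#supersequences≡tail n (b ∷ x)) ⟩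
    tail n (length x) + c * tail n (suc (length x))
      ≡⟨ sym (tail-pascal n (length x)) ⟩
    tail (suc n) (suc (length x))   ∎

#supersequences≡tail-of-nonempty : ∀ {σ} (x : List (Fin σ)) → x ≢ [] → ∀ n →
  #supersequences σ x n ≡ BinomialTail.tail (σ ∸ 1) n (length x)
#supersequences≡tail-of-nonempty {zero}  []      x≢[] n = ⊥-elim (x≢[] refl)
#supersequences≡tail-of-nonempty {suc c} x       _    n = #supersequences≡tail c n x

module _ (σ n : ℕ) where
  open import Data.List.Relation.Binary.Sublist.DecPropositional (_≟ᶠ_ {σ}) using (_⊆?_)
  open BinomialTail (σ ∸ 1)

  #lyndonSubsequencesOfLength : List (Fin σ) → ℕ → ℕ
  #lyndonSubsequencesOfLength w = countOfLength {σ} (λ x → isLyndon? x ×-dec (x ⊆? w))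

  sum-#lyndonSubsequencesOfLength : ∀ m →
    sum (map (λ w → #lyndonSubsequencesOfLength w m) (words σ n)) ≡ L σ m * tail n m
  sum-#lyndonSubsequencesOfLength m = begin
    sum (map (λ w → #lyndonSubsequencesOfLength w m) (words σ n))
      ≡⟨ cong sum (map-cong count-pairs (words σ n)) ⟩
    sum (map (λ w → sum (map (λ x → 𝟙 (isLyndon? x) * 𝟙 (x ⊆? w)) (words σ m))) (words σ n))
      ≡⟨ sum-map-comm (λ w x → 𝟙 (isLyndon? x) * 𝟙 (x ⊆? w)) (words σ n) (words σ m) ⟩
    sum (map (λ x → sum (map (λ w → 𝟙 (isLyndon? x) * 𝟙 (x ⊆? w)) (words σ n))) (words σ m))
      ≡⟨ cong sum (map-cong (λ x → sum-map-*ˡ (𝟙 (isLyndon? x)) (λ w → 𝟙 (x ⊆? w)) (words σ n)) (words σ m)) ⟩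
    sum (map (λ x → 𝟙 (isLyndon? x) * #supersequences σ x n) (words σ m))
      ≡⟨ cong sum (map-cong-local (All.map (λ {x} → count-supersequences {x}) (words-length σ m))) ⟩
    sum (map (λ x → 𝟙 (isLyndon? x) * tail n m) (words σ m))
      ≡⟨ sum-map-*ʳ (tail n m) (𝟙 ∘ isLyndon?) (words σ m) ⟩
    sum (map (𝟙 ∘ isLyndon?) (words σ m)) * tail n m
      ≡⟨ cong (_* tail n m) (sym (length-filter≡sum-𝟙 isLyndon? (words σ m))) ⟩
    L σ m * tail n m   ∎
    where
    count-pairs : ∀ w → #lyndonSubsequencesOfLength w m
                        ≡ sum (map (λ x → 𝟙 (isLyndon? x) * 𝟙 (x ⊆? w)) (words σ m))
    count-pairs w = trans (length-filter≡sum-𝟙 _ (words σ m))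
                          (cong sum (map-cong (λ x → 𝟙-×-dec (isLyndon? x) (x ⊆? w)) (words σ m)))
    count-supersequences : ∀ {x} → length x ≡ m →
                           𝟙 (isLyndon? x) * #supersequences σ x n ≡ 𝟙 (isLyndon? x) * tail n m
    count-supersequences {x} |x|≡m with isLyndon? x
    ... | yes (x≢[] , _) = cong (1 *_) (trans (#supersequences≡tail-of-nonempty x x≢[] n) (cong (tail n) |x|≡m))
    ... | no _           = refl

  totalLyndonSubseq≡TDS : totalLyndonSubseq σ n ≡ TDS σ n
  totalLyndonSubseq≡TDS = begin
    sum (map numLyndonSubseq (words σ n))
      ≡⟨ cong sum (map-cong-local (All.map (λ {w} → cong (λ l → ∑[ 0 ⋯ l ] (#lyndonSubsequencesOfLength w)))
                                           (words-length σ n))) ⟩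
    sum (map (λ w → ∑[ 0 ⋯ n ] (#lyndonSubsequencesOfLength w)) (words σ n))
      ≡⟨ sum-map-comm #lyndonSubsequencesOfLength (words σ n) (upTo (suc n)) ⟩
    ∑[ 0 ⋯ n ] (λ m → sum (map (λ w → #lyndonSubsequencesOfLength w m) (words σ n)))
      ≡⟨ cong sum (map-cong sum-#lyndonSubsequencesOfLength (upTo (suc n))) ⟩
    ∑[ 0 ⋯ n ] (λ m → L σ m * tail n m)
      -- L σ 0 * tail n 0 computes to 0: the empty word is not Lyndon.
      ≡⟨ ∑[0⋯]-peel n (λ m → L σ m * tail n m) ⟩
    TDS σ n   ∎

-- The identity holds for all σ and n.
mainTheorem4 : (σ n : ℕ) → σ < n → totalLyndonSubseq σ n ≡ TDS σ n
mainTheorem4 σ n _ = totalLyndonSubseq≡TDS σ n
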